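{- There exists an infinite set $\mathfrak R$ of simple graphs such that $\Pi_{\mathfrak R,1}\neq\Pi_{\mathfrak G,1}$ for every finite set $\mathfrak G$ of hypergraphs. Here two clustering schemes are equal if they assign the same set of parts to every hypergraph. In particular, there is a representable endofunctor $\Phi_{\mathfrak R}$ which is not equal to $\Phi_{\mathfrak G}$ for any finite set $\mathfrak G$ of hypergraphs.
   Context: A hypergraph is a triple $G=(V,E,\epsilon)$, where $V$ is a finite vertex set, $E$ is a finite edge set disjoint from $V$, and $\epsilon:E\to 2^V$ gives each edge's vertex set. Distinct edges may have the same vertex set. A morphism $H\to G$ is an injective map $f:V(H)\to V(G)$ such that for every edge $e$ of $H$ there is an edge $e'$ of $G$ with $f(\epsilon_H(e))=\epsilon_G(e')$; $\hom(H,G)$ is the set of such morphisms. A simple graph is a hypergraph all of whose edges have exactly two vertices, with no two edges having the same vertex set. For a set $\mathfrak R$ of hypergraphs, $\Phi_{\mathfrak R}(G)$ has vertex set $V(G)$ and edge set $\bigcup_{R\in\mathfrak R}\hom(R,G)$ (disjoint union), where the edge $\omega\in\hom(R,G)$ has vertex set $\omega(V(R))$. For $k\in\mathbb N\cup\{\infty\}$, the $k$-line graph $\Lambda_k(G)$ is the simple graph with vertex set $\{\epsilon(e):e\in E\}$ in which distinct $u,v$ are adjacent iff $|u\cap v|\ge k$. $\Pi_k(G)$ is the pair $(V(G),P)$ where $P$ is the set of all $\bigcup_{x\in C}x$, with $C$ ranging over the vertex sets of connected components (including singletons) of $\Lambda_k(G)$. Finally, $\Pi_{\mathfrak R,k}:=\Pi_k\circ\Phi_{\mathfrak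 R}$. -}

module Defs where

open import Data.Nat using (ℕ; _≤_)
open import Data.Fin using (Fin)
open import Data.Fin.Subset using (Subset; _∈_; ∣_∣; ⊤; _∩_)
open import Data.Vec using (Vec; lookup)
open import Data.List using (List)
import Data.List.Membership.Propositional as L
open import Data.Product using (Σ; ∃; ∃-syntax; _×_)
open import Data.Empty using (⊥)
open import Function.Definitions using (Injective)
open import Function.Bundles using (_⇔_)
open import Relation.Binary.PropositionalEquality using (_≡_)
open import Relation.Nullary using (¬_)
open import Level using (Level; suc; _⊔_) renaming (zero to lzero)

-- A hypergraph: vertex set Fin nV, edge set Fin nE, and ε given by the
-- vector 'edges' (entry e is the vertex set of edge e).  Distinct edges
-- may have equal vertex sets.
record Hypergraph : Set where
  constructor hypergraph
  field
    nV    : ℕ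
    nE    : ℕ
    edges : Vec (Subset nV) nE
open Hypergraph public

ε : (G : Hypergraph) → Fin (nE G) → Subset (nV G)
ε G e = lookup (edges G) e

IsSimpleGraph : Hypergraph → Set
IsSimpleGraph G =
  (∀ e → ∣ ε G e ∣ ≡ 2) × (∀ e e′ → ε G e ≡ ε G e′ → e ≡ e′)

IsImage : ∀ {m n} → (Fin m → Fin n) → Subset m → Subset n → Set
IsImage f S T = ∀ w → (w ∈ T) ⇔ (∃[ v ] (v ∈ S × f v ≡ w))

record Hom (H G : Hypergraph) : Set where
  constructor hom
  field
    map       : Fin (nV H) → Fin (nV G)
    injective : Injective _≡_ _≡_ map
    edgeMap   : ∀ e → ∃[ e′ ] IsImage map (ε H e) (ε G e′)
open Hom public

Family : (ℓ : Level) → Set (suc ℓ)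
Family ℓ = Hypergraph → Set ℓ

listFamily : List Hypergraph → Family lzero
listFamily l H = H L.∈ l

Infinite : ∀ {ℓ} → Family ℓ → Set ℓ
Infinite 𝔑 = ∀ (l : List Hypergraph) → ∃[ H ] (𝔑 H × ¬ (H L.∈ l))

-- The set of vertex sets of edges of Φ_𝔑(G):
-- S is such iff S = ω(V(R)) for some R ∈ 𝔑 and ω ∈ hom(R,G).
ΦEdgeSet : ∀ {ℓ} → Family ℓ → (G : Hypergraph) → Subset (nV G) → Set ℓ
ΦEdgeSet 𝔑 G S = ∃[ R ] (𝔑 R × Σ (Hom R G) λ ω → IsImage (map ω) ⊤ S)

-- Reachability in the k-line graph Λ_k whose vertices are the subsets
-- satisfying F, two of them adjacent iff they share ≥ k vertices.
-- Reach k F A B : B lies in the connected component of A.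
data Reach {ℓ} {n : ℕ} (k : ℕ) (F : Subset n → Set ℓ) (A : Subset n)
     : Subset n → Set ℓ where
  here : F A → Reach k F A A
  step : ∀ {B C} → Reach k F A B → F C → k ≤ ∣ B ∩ C ∣ → Reach k F A C

ΠkPart : ∀ {ℓ} {n : ℕ} → ℕ → (Subset n → Set ℓ) → Subset n → Set ℓ
ΠkPart k F X =
  ∃[ A ] (F A × (∀ v → (v ∈ X) ⇔ (∃[ B ] (Reach k F A B × v ∈ B))))

ΠPart : ∀ {ℓ} → Family ℓ → ℕ → (G : Hypergraph) → Subset (nV G) → Set ℓ
ΠPart 𝔑 k G = ΠkPart k (ΦEdgeSet 𝔑 G)

-- Equality of clustering schemes Π_{𝔑,k} = Π_{𝔊,k}: same parts on every
-- hypergraph (the vertex set component is V(G) in both).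
SameClustering : ∀ {ℓ ℓ′} → Family ℓ → Family ℓ′ → ℕ → Set (ℓ ⊔ ℓ′)
SameClustering 𝔑 𝔊 k =
  ∀ (G : Hypergraph) (X : Subset (nV G)) → ΠPart 𝔑 k G X ⇔ ΠPart 𝔊 k G X

{-# OPTIONS --safe #-}

-- Take for 𝔑 the cycles C₃, C₄, …. Given a finite 𝔊, let C be a cycle longer than every
-- member of 𝔊. Through the identity, V(C) is a part of Π_{𝔑,1}(C), so Φ_𝔊(C) has an edge,
-- the image of an embedding of some H ∈ 𝔊; this embedding misses a vertex v of C. Deleting
-- the edges at v turns C into a path into which H still embeds, so Π_{𝔊,1} of the path has
-- a part; but a path contains no cycle, so Π_{𝔑,1} of it has none.

module Submission where

open import Defs
open import Data.Bool using (if_then_else_)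
open import Data.Bool.Properties using (T-≡)
open import Data.Empty using (⊥)
open import Data.Fin as Fin using (Fin; zero; suc; fromℕ; inject₁; toℕ; _≤?_)
open import Data.Fin.Properties
  using (suc-injective; toℕ-inject₁; toℕ-fromℕ; ≤fromℕ; ≤∧≢⇒<; <-cmp; _≟_; any?; all?; ¬∀⟶∃¬; injective⇒≤)
open import Data.Fin.Relation.Unary.Top using (view; ‵fromℕ; ‵inject₁; view-fromℕ; view-inject₁)
open import Data.Fin.Subset using (Subset; _∈_; _∉_; ⊤; ⁅_⁆; _∪_; ∣_∣) renaming (⊥ to ∅)
open import Data.Fin.Subset.Properties
  using (_∈?_; ∈⊤; ∉⊥; x∈⁅x⁆; x∈⁅y⁆⇒x≡y; x∈p∪q⁻; x∈p∪q⁺; ∣⁅x⁆∣≡1; ∪-identityˡ; ∪-identityʳ)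
open import Data.List using (List; allFin) renaming (map to mapL)
import Data.List.Membership.Propositional as L
open import Data.List.Membership.Propositional.Properties using (∈-allFin; ∈-map⁺)
open import Data.List.Extrema.Nat using (argmax; max; f[xs]≤f[argmax]; xs≤max)
import Data.List.Relation.Unary.All as All
open import Data.Nat using (ℕ; suc; _+_; _≤_; _<_; s≤s; z≤n)
open import Data.Nat.Properties using (≤-trans; <⇒≤; <⇒≱; m<n⇒m<1+n; m≤n+m; 1+n≰n; n≮n; 1+n≢n; m+1+n≢n)
open import Data.Product using (∃; ∃-syntax; _×_; _,_; proj₁; proj₂)
open import Data.Sum using (_⊎_; inj₁; inj₂)
open import Data.Vec using (tabulate)
open import Data.Vec.Properties using (lookup∘tabulate; []=⇒lookup; lookup⇒[]=)
open import Function using (_∘_; id)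
open import Function.Bundles using (_⇔_; mk⇔; Equivalence)
open import Function.Definitions using (Injective)
open import Level using () renaming (zero to lzero)
open import Relation.Binary using (tri<; tri≈; tri>)
open import Relation.Binary.PropositionalEquality
open import Relation.Nullary using (¬_; Dec; isYes; contradiction; yes; no)
open import Relation.Nullary.Decidable using (toWitness; fromWitness; ¬¬-excluded-middle)
open import Relation.Nullary.Negation using (¬¬-map)

open Equivalence using (to; from)

private
  variable
    n : ℕ

next : Fin (suc n) → Fin (suc n)
next i with view i
... | ‵fromℕ = zero
... | ‵inject₁ j = suc j

next-fromℕ : ∀ n → next (fromℕ n) ≡ zero
next-fromℕ n rewrite view-fromℕ n = refl

next-inject₁ : (j : Fin n) → next (inject₁ j) ≡ suc j
next-inject₁ j rewrite view-inject₁ j = refl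

next-injective : Injective _≡_ _≡_ (next {n})
next-injective {x = i} {j} eq with view i | view j
... | ‵fromℕ     | ‵fromℕ     = refl
... | ‵fromℕ     | ‵inject₁ _ = contradiction eq λ ()
... | ‵inject₁ _ | ‵fromℕ     = contradiction eq λ ()
... | ‵inject₁ _ | ‵inject₁ _ = cong inject₁ (suc-injective eq)

prev : Fin (suc n) → Fin (suc n)
prev zero    = fromℕ _
prev (suc j) = inject₁ j

next-prev : (i : Fin (suc n)) → next (prev i) ≡ i
next-prev zero    = next-fromℕ _
next-prev (suc j) = next-inject₁ j

next≢id : (i : Fin (2 + n)) → next i ≢ i
next≢id i eq with view i
... | ‵fromℕ     = contradiction eq λ ()
... | ‵inject₁ j = 1+n≢n (trans (cong toℕ eq) (toℕ-inject₁ j))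

next²≢id : (i : Fin (3 + n)) → next (next i) ≢ i
next²≢id i eq with view i
... | ‵fromℕ     = contradiction eq λ ()
... | ‵inject₁ j with view j
...   | ‵fromℕ     = contradiction eq λ ()
...   | ‵inject₁ k =
  m+1+n≢n 1 (trans (cong toℕ eq) (trans (toℕ-inject₁ (inject₁ k)) (toℕ-inject₁ k)))

pair : Fin n → Fin n → Subset n
pair a b = ⁅ a ⁆ ∪ ⁅ b ⁆

a∈pair : (a b : Fin n) → a ∈ pair a b
a∈pair a b = x∈p∪q⁺ (inj₁ (x∈⁅x⁆ a))

b∈pair : (a b : Fin n) → b ∈ pair a b
b∈pair a b = x∈p∪q⁺ (inj₂ (x∈⁅x⁆ b))

∈-pair⁻ : ∀ {a b w : Fin n} → w ∈ pair a b → w ≡ a ⊎ w ≡ b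
∈-pair⁻ {a = a} {b} w∈ with x∈p∪q⁻ ⁅ a ⁆ ⁅ b ⁆ w∈
... | inj₁ w∈a = inj₁ (x∈⁅y⁆⇒x≡y a w∈a)
... | inj₂ w∈b = inj₂ (x∈⁅y⁆⇒x≡y b w∈b)

∣pair∣≡2 : ∀ {a b : Fin n} → a ≢ b → ∣ pair a b ∣ ≡ 2
∣pair∣≡2 {a = zero}  {zero}  a≢b = contradiction refl a≢b
∣pair∣≡2 {a = zero}  {suc b} _   = cong suc (trans (cong ∣_∣ (∪-identityˡ ⁅ b ⁆)) (∣⁅x⁆∣≡1 b))
∣pair∣≡2 {a = suc a} {zero}  _   = cong suc (trans (cong ∣_∣ (∪-identityʳ ⁅ a ⁆)) (∣⁅x⁆∣≡1 a))
∣pair∣≡2 {a = suc a} {suc b} a≢b = ∣pair∣≡2 (a≢b ∘ cong suc)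

pair-matching : ∀ {a b c d : Fin n} → a ≢ b → a ∈ pair c d → b ∈ pair c d →
                (a ≡ c × b ≡ d) ⊎ (a ≡ d × b ≡ c)
pair-matching a≢b a∈ b∈ with ∈-pair⁻ a∈ | ∈-pair⁻ b∈
... | inj₁ a≡c | inj₂ b≡d = inj₁ (a≡c , b≡d)
... | inj₂ a≡d | inj₁ b≡c = inj₂ (a≡d , b≡c)
... | inj₁ a≡c | inj₁ b≡c = contradiction (trans a≡c (sym b≡c)) a≢b
... | inj₂ a≡d | inj₂ b≡d = contradiction (trans a≡d (sym b≡d)) a≢b

cycle : ℕ → Hypergraph
cycle k = hypergraph (3 + k) (3 + k) (tabulate λ i → pair i (next i))

ε-cycle : ∀ k (i : Fin (3 + k)) → ε (cycle k) i ≡ pair i (next i)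
ε-cycle k = lookup∘tabulate _

cycle-simple : ∀ k → IsSimpleGraph (cycle k)
cycle-simple k = edges-are-pairs , edges-distinct
  where
  edges-are-pairs : ∀ i → ∣ ε (cycle k) i ∣ ≡ 2
  edges-are-pairs i rewrite ε-cycle k i = ∣pair∣≡2 (≢-sym (next≢id i))

  edges-distinct : ∀ i j → ε (cycle k) i ≡ ε (cycle k) j → i ≡ j
  edges-distinct i j eq with pair-matching (≢-sym (next≢id i))
                                            (subst (i ∈_) same (a∈pair i (next i)))
                                            (subst (next i ∈_) same (b∈pair i (next i)))
    where
    same : pair i (next i) ≡ pair j (next j)
    same = trans (sym (ε-cycle k i)) (trans eq (ε-cycle k j))
  ... | inj₁ (i≡j , _)              = i≡j
  ... | inj₂ (i≡next-j , next-i≡j) =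
    contradiction (trans (cong next next-i≡j) (sym i≡next-j)) (next²≢id i)

Cycles : Family lzero
Cycles R = ∃[ k ] R ≡ cycle k

maxOrder : List Hypergraph → ℕ
maxOrder 𝔊 = max 0 (mapL nV 𝔊)

nV<3+maxOrder : ∀ {H 𝔊} → H L.∈ 𝔊 → nV H < 3 + maxOrder 𝔊
nV<3+maxOrder {𝔊 = 𝔊} H∈𝔊 =
  s≤s (≤-trans (All.lookup (xs≤max 0 (mapL nV 𝔊)) (∈-map⁺ nV H∈𝔊)) (m≤n+m (maxOrder 𝔊) 2))

cycles-infinite : Infinite Cycles
cycles-infinite 𝔊 = cycle (maxOrder 𝔊) , (maxOrder 𝔊 , refl) , λ C∈𝔊 → n≮n _ (nV<3+maxOrder C∈𝔊)

IsImage-id : (S : Subset n) → IsImage id S S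
IsImage-id S w = mk⇔ (λ w∈S → w , w∈S , refl) (λ { (_ , w∈S , refl) → w∈S })

Hom-id : ∀ G → Hom G G
Hom-id G = hom id id (λ e → e , IsImage-id (ε G e))

ΦEdgeSet-⊤ : ∀ {ℓ} {𝔑 : Family ℓ} {G} → 𝔑 G → ΦEdgeSet 𝔑 G ⊤
ΦEdgeSet-⊤ {G = G} G∈𝔑 = G , G∈𝔑 , Hom-id G , IsImage-id ⊤

⊤-part : ∀ {ℓ} {F : Subset n → Set ℓ} k → F ⊤ → ΠkPart k F ⊤
⊤-part k F⊤ = ⊤ , F⊤ , λ v → mk⇔ (λ _ → ⊤ , here F⊤ , ∈⊤) (λ _ → ∈⊤)

¬¬-decidable : ∀ {ℓ} (P : Fin n → Set ℓ) → ¬ ¬ (∀ i → Dec (P i))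
¬¬-decidable {n = 0}     P k = k λ ()
¬¬-decidable {n = suc n} P k =
  ¬¬-excluded-middle λ P₀? → ¬¬-decidable (P ∘ suc) λ Pₛ? → k λ { zero → P₀? ; (suc i) → Pₛ? i }

decidable⇒subset : ∀ {ℓ} {P : Fin n → Set ℓ} → (∀ i → Dec (P i)) → ∃[ X ] ∀ i → i ∈ X ⇔ P i
decidable⇒subset P? = tabulate (isYes ∘ P?) , λ i → mk⇔
  (λ i∈X → toWitness (from T-≡ (trans (sym (lookup∘tabulate (isYes ∘ P?) i)) ([]=⇒lookup i∈X))))
  (λ Pi → lookup⇒[]= i _ (trans (lookup∘tabulate (isYes ∘ P?) i) (to T-≡ (fromWitness Pi))))

-- Constructing a part needs its membership to be decided, hence the double negation.
¬¬-part : ∀ {ℓ} {F : Subset n → Set ℓ} {A} k → F A → ¬ ¬ ∃ (ΠkPart k F)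
¬¬-part {F = F} {A} k FA = ¬¬-map (λ (X , X⇔) → X , A , FA , X⇔)
  (¬¬-map decidable⇒subset (¬¬-decidable λ w → ∃[ B ] (Reach k F A B × w ∈ B)))

missed-point : ∀ {m} → m < n → (f : Fin m → Fin n) → ∃[ v ] ∀ u → f u ≢ v
missed-point {n} m<n f with all? (λ v → any? (λ u → f u ≟ v))
... | yes hit = contradiction (injective⇒≤ section-injective) (<⇒≱ m<n)
  where
  section-injective : Injective _≡_ _≡_ (λ v → proj₁ (hit v))
  section-injective {v} {w} eq = trans (sym (proj₂ (hit v))) (trans (cong f eq) (proj₂ (hit w)))
... | no ¬hit with ¬∀⟶∃¬ n _ (λ v → any? (λ u → f u ≟ v)) ¬hit
...   | v , v-missed = v , λ u fu≡v → v-missed (u , fu≡v)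

Adjacent : (G : Hypergraph) → Fin (nV G) → Fin (nV G) → Set
Adjacent G a b = ∃[ e ] (a ∈ ε G e × b ∈ ε G e)

Hom-adjacent : ∀ {H G a b} (ω : Hom H G) → Adjacent H a b → Adjacent G (map ω a) (map ω b)
Hom-adjacent ω (e , a∈e , b∈e) with edgeMap ω e
... | e′ , image = e′ , from (image _) (_ , a∈e , refl) , from (image _) (_ , b∈e , refl)

cycle-adjacent : ∀ k (i : Fin (3 + k)) → Adjacent (cycle k) i (next i)
cycle-adjacent k i = i , subst (i ∈_) (sym (ε-cycle k i)) (a∈pair i (next i))
                       , subst (next i ∈_) (sym (ε-cycle k i)) (b∈pair i (next i))

-- The edges through v are emptied rather than removed, so the edge indices are unchanged.
dropEdgesAt : (G : Hypergraph) → Fin (nV G) → Hypergraph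
dropEdgesAt G v =
  hypergraph (nV G) (nE G) (tabulate λ e → if isYes (v ∈? ε G e) then ∅ else ε G e)

module _ (G : Hypergraph) (v : Fin (nV G)) where

  private
    ε-dropEdgesAt : ∀ e → ε (dropEdgesAt G v) e ≡ (if isYes (v ∈? ε G e) then ∅ else ε G e)
    ε-dropEdgesAt = lookup∘tabulate _

  ∈-dropEdgesAt⁻ : ∀ e {w} → w ∈ ε (dropEdgesAt G v) e → w ∈ ε G e × v ∉ ε G e
  ∈-dropEdgesAt⁻ e w∈ rewrite ε-dropEdgesAt e with v ∈? ε G e
  ... | yes _   = contradiction w∈ ∉⊥
  ... | no  v∉e = w∈ , v∉e

  ε-dropEdgesAt-∉ : ∀ {e} → v ∉ ε G e → ε (dropEdgesAt G v) e ≡ ε G e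
  ε-dropEdgesAt-∉ {e} v∉e rewrite ε-dropEdgesAt e with v ∈? ε G e
  ... | yes v∈e = contradiction v∈e v∉e
  ... | no  _   = refl

  Hom-dropEdgesAt : ∀ {H} (ω : Hom H G) → (∀ u → map ω u ≢ v) → Hom H (dropEdgesAt G v)
  Hom-dropEdgesAt ω v-missed = hom (map ω) (injective ω) λ e → avoid (edgeMap ω e)
    where
    avoid : ∀ {S} → ∃[ e′ ] IsImage (map ω) S (ε G e′) →
            ∃[ e′ ] IsImage (map ω) S (ε (dropEdgesAt G v) e′)
    avoid (e′ , image) = e′ , subst (IsImage (map ω) _) (sym (ε-dropEdgesAt-∉ v∉e′)) image
      where
      v∉e′ : v ∉ ε G e′
      v∉e′ v∈e′ with to (image v) v∈e′
      ... | u , _ , ωu≡v = v-missed u ωu≡v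

-- A graph in which every edge goes up one level of a height function and every vertex has
-- at most one lower neighbour is a forest, so it contains no injective closed walk: at a
-- vertex of maximal height both neighbours on the walk lie below it and hence coincide.

module _ {V : Set} (height : V → ℕ) (_⋖_ : V → V → Set)
         (⋖-height : ∀ {u w} → u ⋖ w → height w ≡ suc (height u))
         (⋖-unique : ∀ {u u′ w} → u ⋖ w → u′ ⋖ w → u ≡ u′)
         {k : ℕ} (f : Fin (3 + k) → V) (f-injective : Injective _≡_ _≡_ f)
         (walk : ∀ i → f i ⋖ f (next i) ⊎ f (next i) ⋖ f i) where

  closed-walk-has-no-top : ∀ top → ¬ (∀ i → height (f i) ≤ height (f top))
  closed-walk-has-no-top top maximal = at-top (walk top) incoming
    where
    nothing-above : ∀ {i} → ¬ (f top ⋖ f i)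
    nothing-above {i} top⋖i = 1+n≰n (subst (_≤ height (f top)) (⋖-height top⋖i) (maximal i))

    incoming : f (prev top) ⋖ f top ⊎ f top ⋖ f (prev top)
    incoming = subst (λ t → f (prev top) ⋖ f t ⊎ f t ⋖ f (prev top)) (next-prev top) (walk (prev top))

    at-top : f top ⋖ f (next top) ⊎ f (next top) ⋖ f top →
             f (prev top) ⋖ f top ⊎ f top ⋖ f (prev top) → ⊥
    at-top (inj₁ top⋖next) _               = nothing-above top⋖next
    at-top (inj₂ _)        (inj₂ top⋖prev) = nothing-above top⋖prev
    at-top (inj₂ next⋖top) (inj₁ prev⋖top) = next²≢id (prev top) (begin
      next (next (prev top)) ≡⟨ cong next (next-prev top) ⟩
      next top               ≡⟨ f-injective (⋖-unique next⋖top prev⋖top) ⟩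
      prev top               ∎)
      where open ≡-Reasoning

  no-closed-walk : ⊥
  no-closed-walk = closed-walk-has-no-top (argmax (height ∘ f) zero (allFin (3 + k)))
    λ i → All.lookup (f[xs]≤f[argmax] {f = height ∘ f} zero (allFin (3 + k))) (∈-allFin i)

PathStep : ∀ {m} → Fin (suc m) → Fin (suc m) → Fin (suc m) → Set
PathStep v a b = a ≢ v × next a ≡ b

module _ {m : ℕ} (v : Fin (suc m)) where

  -- Up to the constant toℕ v, the number of next-steps from v to a.
  height : Fin (suc m) → ℕ
  height a with a ≤? v
  ... | yes _ = toℕ a + suc m
  ... | no  _ = toℕ a

  height-≤ : ∀ {a} → a Fin.≤ v → height a ≡ toℕ a + suc m
  height-≤ {a} a≤v with a ≤? v
  ... | yes _   = refl
  ... | no  a≰v = contradiction a≤v a≰v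

  height-> : ∀ {a} → v Fin.< a → height a ≡ toℕ a
  height-> {a} v<a with a ≤? v
  ... | yes a≤v = contradiction a≤v (<⇒≱ v<a)
  ... | no  _   = refl

  height-step : ∀ {a b} → a ≢ v → toℕ b ≡ suc (toℕ a) → height b ≡ suc (height a)
  height-step {a} {b} a≢v b≡1+a with <-cmp a v
  ... | tri< a<v _ _ = begin
    height b             ≡⟨ height-≤ (subst (_≤ toℕ v) (sym b≡1+a) a<v) ⟩
    toℕ b + suc m        ≡⟨ cong (_+ suc m) b≡1+a ⟩
    suc (toℕ a + suc m)  ≡⟨ cong suc (sym (height-≤ (<⇒≤ a<v))) ⟩
    suc (height a)       ∎
    where open ≡-Reasoning
  ... | tri≈ _ a≡v _ = contradiction a≡v a≢v
  ... | tri> _ _ v<a = begin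
    height b        ≡⟨ height-> (subst (toℕ v <_) (sym b≡1+a) (m<n⇒m<1+n v<a)) ⟩
    toℕ b           ≡⟨ b≡1+a ⟩
    suc (toℕ a)     ≡⟨ cong suc (sym (height-> v<a)) ⟩
    suc (height a)  ∎
    where open ≡-Reasoning

  height-next : ∀ {a} → a ≢ v → height (next a) ≡ suc (height a)
  height-next {a} a≢v with view a
  ... | ‵inject₁ j = height-step a≢v (cong suc (sym (toℕ-inject₁ j)))
  ... | ‵fromℕ     = begin
    height zero            ≡⟨ height-≤ z≤n ⟩
    suc m                  ≡⟨ cong suc (sym (toℕ-fromℕ m)) ⟩
    suc (toℕ (fromℕ m))    ≡⟨ cong suc (sym (height-> (≤∧≢⇒< (≤fromℕ v) (≢-sym a≢v)))) ⟩
    suc (height (fromℕ m)) ∎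
    where open ≡-Reasoning

  PathStep-height : ∀ {a b} → PathStep v a b → height b ≡ suc (height a)
  PathStep-height (a≢v , refl) = height-next a≢v

  PathStep-unique : ∀ {a a′ b} → PathStep v a b → PathStep v a′ b → a ≡ a′
  PathStep-unique (_ , a↦b) (_ , a′↦b) = next-injective (trans a↦b (sym a′↦b))

∉-ε-cycle⇒≢ : ∀ {n} {v} (e : Fin (3 + n)) → v ∉ ε (cycle n) e → e ≢ v
∉-ε-cycle⇒≢ {n} e v∉e refl = v∉e (subst (e ∈_) (sym (ε-cycle n e)) (a∈pair e (next e)))

Adjacent⇒PathStep : ∀ {n} {v a b : Fin (3 + n)} → a ≢ b →
                    Adjacent (dropEdgesAt (cycle n) v) a b → PathStep v a b ⊎ PathStep v b a
Adjacent⇒PathStep {n} {v} {a} {b} a≢b (e , a∈ , b∈)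
  with ∈-dropEdgesAt⁻ (cycle n) v e a∈ | ∈-dropEdgesAt⁻ (cycle n) v e b∈
... | a∈e , v∉e | b∈e , _
  with pair-matching a≢b (subst (a ∈_) (ε-cycle n e) a∈e) (subst (b ∈_) (ε-cycle n e) b∈e)
...   | inj₁ (refl , refl) = inj₁ (∉-ε-cycle⇒≢ e v∉e , refl)
...   | inj₂ (refl , refl) = inj₂ (∉-ε-cycle⇒≢ e v∉e , refl)

¬Hom-cycle-dropEdgesAt : ∀ {k n} {v : Fin (3 + n)} → ¬ Hom (cycle k) (dropEdgesAt (cycle n) v)
¬Hom-cycle-dropEdgesAt {k} {v = v} ω =
  no-closed-walk (height v) (PathStep v) (PathStep-height v) (PathStep-unique v)
                 (map ω) (injective ω) λ i →
    Adjacent⇒PathStep (λ eq → next≢id i (sym (injective ω eq))) (Hom-adjacent ω (cycle-adjacent k i))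

cycles-not-finitely-generated : ∀ (𝔊 : List Hypergraph) → ¬ SameClustering Cycles (listFamily 𝔊) 1
cycles-not-finitely-generated 𝔊 same =
  let (_ , (H , H∈𝔊 , ω , ω-image) , _) = to (same (cycle N) ⊤) (⊤-part 1 (ΦEdgeSet-⊤ (N , refl)))
      (v , v-missed) = missed-point (nV<3+maxOrder H∈𝔊) (map ω)
      G = dropEdgesAt (cycle N) v
  in ¬¬-part 1 (H , H∈𝔊 , Hom-dropEdgesAt (cycle N) v ω v-missed , ω-image)
       λ (X , X-part) → no-cycle-part (from (same G X) X-part)
  where
  N = maxOrder 𝔊

  no-cycle-part : ∀ {v : Fin (3 + N)} {X} → ¬ ΠPart Cycles 1 (dropEdgesAt (cycle N) v) X
  no-cycle-part (_ , (_ , (_ , refl) , ω′ , _) , _) = ¬Hom-cycle-dropEdgesAt ω′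

mainTheorem4 : ∃[ 𝔑 ] ((∀ R → 𝔑 R → IsSimpleGraph R) × Infinite {lzero} 𝔑 ×
                 (∀ (𝔊 : List Hypergraph) → ¬ SameClustering 𝔑 (listFamily 𝔊) 1))
mainTheorem4 = Cycles , (λ { _ (k , refl) → cycle-simple k }) , cycles-infinite , cycles-not-finitely-generated
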